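{- For $N\ge 0$ let $a_N$ be the number of tilings of the $8\times \tfrac{N}{2}$ rectangle by $1\times 4$ tiles when $N/2$ is a positive integer, $a_N=0$ when $N$ is odd, and $a_0=1$. Then $\sum_{N\ge 0} a_N z^N=p(z)/q(z)$ with $$p(z)=(1-z^2)^3(1+z^2)^3(1+z^4)^3(1-z^4-z^6-z^8+z^{12}),$$ $$q(z)=1-z^2-z^4-9z^8+2z^{10}+8z^{12}+5z^{14}+16z^{16}-13z^{20}-6z^{22}-13z^{24}-2z^{26}+10z^{28}+6z^{30}+6z^{32}+z^{34}-5z^{36}-2z^{38}-z^{40}+z^{44},$$ and $p/q=1+z^2+z^4+z^6+7z^8+15z^{10}+25z^{12}+37z^{14}+100z^{16}+229z^{18}+\cdots$.
   Context: A tiling of an $m\times n$ rectangle (made of $mn$ unit squares) by $a\times b$ tiles is a set of non-overlapping axis-parallel $a\times b$ or $b\times a$ rectangles with integer corners whose union is the rectangle; both orientations may be mixed. Tilings related by a symmetry of the rectangle are counted separately. The index $N$ is the number of tiles used. -}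

module Defs where

open import Data.Bool using (Bool; true; false; _∧_; if_then_else_)
open import Data.Nat using (ℕ; zero; suc; _+_; _∸_; _≡ᵇ_; _≤ᵇ_; _/_; _%_)
open import Data.List using (List; []; _∷_; concatMap; length; filterᵇ; upTo)
open import Data.Nat.ListAction using (sum)
open import Data.Bool.ListAction using (and)
open import Data.Vec using (Vec; []; _∷_; toList)
open import Data.Integer as ℤ using (ℤ; +_; -_)

-- A tiling (a set of tiles) is encoded canonically by marking each tile's
-- top-left cell: every cell carries a Mark saying whether it is the
-- top-left cell of a horizontal 1×4 tile, of a vertical 4×1 tile, or of
-- no tile.  Distinct tiles of a tiling have distinct top-left cells, so
-- valid markings are in bijection with tilings.

data Mark : Set where
  none hor ver : Mark

Grid : ℕ → ℕ → Set
Grid m n = Vec (Vec Mark n) m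

allMarks : List Mark
allMarks = none ∷ hor ∷ ver ∷ []

allVecs : {A : Set} → List A → (n : ℕ) → List (Vec A n)
allVecs xs zero    = [] ∷ []
allVecs xs (suc n) = concatMap (λ x → Data.List.map (x ∷_) (allVecs xs n)) xs

allGrids : (m n : ℕ) → List (Grid m n)
allGrids m n = allVecs (allVecs allMarks n) m

nth : {A : Set} → A → List A → ℕ → A
nth d []       _       = d
nth d (x ∷ xs) zero    = x
nth d (x ∷ xs) (suc i) = nth d xs i

rowsOf : {m n : ℕ} → Grid m n → List (List Mark)
rowsOf g = Data.List.map toList (toList g)

markAt : {m n : ℕ} → Grid m n → ℕ → ℕ → Mark
markAt g r c = nth none (nth [] (rowsOf g) r) c

isHor : Mark → Bool
isHor hor = true
isHor _   = false

isVer : Mark → Bool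
isVer ver = true
isVer _   = false

b2n : Bool → ℕ
b2n true  = 1
b2n false = 0

coverCount : {m n : ℕ} → Grid m n → ℕ → ℕ → ℕ
coverCount {m} {n} g r c = sum (Data.List.map cov (upTo 4))
  where
  cov : ℕ → ℕ
  cov k = b2n ((k ≤ᵇ c) ∧ isHor (markAt g r (c ∸ k)))
        + b2n ((k ≤ᵇ r) ∧ isVer (markAt g (r ∸ k) c))

anchorFits : {m n : ℕ} → Grid m n → ℕ → ℕ → Bool
anchorFits {m} {n} g r c with markAt g r c
... | none = true
... | hor  = (c + 4) ≤ᵇ n
... | ver  = (r + 4) ≤ᵇ m

isTiling : {m n : ℕ} → Grid m n → Bool
isTiling {m} {n} g =
  and (concatMap (λ r → Data.List.map (λ c → anchorFits g r c ∧ (coverCount g r c ≡ᵇ 1))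
                                      (upTo n))
                 (upTo m))

numTilings : ℕ → ℕ → ℕ
numTilings m n = length (filterᵇ isTiling (allGrids m n))

a : ℕ → ℕ
a zero = 1
a (suc k) = if (suc k % 2) ≡ᵇ 0 then numTilings 8 (suc k / 2) else 0

-- Integer polynomials as coefficient lists (lowest degree first).

Poly : Set
Poly = List ℤ

_+ₚ_ : Poly → Poly → Poly
[]       +ₚ q        = q
(x ∷ p)  +ₚ []       = x ∷ p
(x ∷ p)  +ₚ (y ∷ q)  = (x ℤ.+ y) ∷ (p +ₚ q)

_*ₚ_ : Poly → Poly → Poly
[]      *ₚ q = []
(x ∷ p) *ₚ q = Data.List.map (x ℤ.*_) q +ₚ (+ 0 ∷ (p *ₚ q))

_^ₚ_ : Poly → ℕ → Poly
p ^ₚ zero  = + 1 ∷ []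
p ^ₚ suc k = p *ₚ (p ^ₚ k)

coeff : Poly → ℕ → ℤ
coeff p i = nth (+ 0) p i

pPoly : Poly
pPoly = ((+ 1 ∷ + 0 ∷ - + 1 ∷ []) ^ₚ 3)
     *ₚ (((+ 1 ∷ + 0 ∷ + 1 ∷ []) ^ₚ 3)
     *ₚ (((+ 1 ∷ + 0 ∷ + 0 ∷ + 0 ∷ + 1 ∷ []) ^ₚ 3)
     *ₚ (+ 1 ∷ + 0 ∷ + 0 ∷ + 0 ∷ - + 1 ∷ + 0 ∷ - + 1 ∷ + 0 ∷ - + 1 ∷ + 0 ∷ + 0 ∷ + 0 ∷ + 1 ∷ [])))

-- q(z) = 1 - z^2 - z^4 - 9z^8 + 2z^10 + 8z^12 + 5z^14 + 16z^16 - 13z^20 - 6z^22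
--        - 13z^24 - 2z^26 + 10z^28 + 6z^30 + 6z^32 + z^34 - 5z^36 - 2z^38
--        - z^40 + z^44, given by its even coefficients q_0, q_2, ..., q_44
qEven : List ℤ
qEven = + 1 ∷ - + 1 ∷ - + 1 ∷ + 0 ∷ - + 9 ∷ + 2 ∷ + 8 ∷ + 5 ∷ + 16 ∷ + 0 ∷ - + 13 ∷ - + 6
      ∷ - + 13 ∷ - + 2 ∷ + 10 ∷ + 6 ∷ + 6 ∷ + 1 ∷ - + 5 ∷ - + 2 ∷ - + 1 ∷ + 0 ∷ + 1 ∷ []

spread : List ℤ → Poly
spread []       = []
spread (x ∷ xs) = x ∷ + 0 ∷ spread xs

qPoly : Poly
qPoly = spread qEven

-- coefficient of z^N in q(z) · Σ_N a_N z^N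
convQA : ℕ → ℤ
convQA N = sumℤ (Data.List.map (λ k → coeff qPoly k ℤ.* + a (N ∸ k)) (upTo (suc N)))
  where
  sumℤ : List ℤ → ℤ
  sumℤ = Data.List.foldr ℤ._+_ (+ 0)

module Submission where

-- Cut the 8 × n rectangle into columns.  Which columns can follow depends
-- only on the overhang profile: how many cells of each row are already covered
-- by horizontal tiles anchored further left.  Exactly 52 profiles are
-- reachable from the empty one, so the numbers of tilings starting from each
-- profile form vectors v(n) with v(n + 1) = T v(n) for an explicit transfer
-- map T (once n ≥ 3 every transition fits), and a_{2n} is the entry of v(n)
-- at the empty profile.  A linear relation Σ_{i<23} q_{2i} v(m - i) = 0 is
-- carried along by T, so checking it for the single window m = 25 gives the
-- vanishing of the coefficient of z^N in q(z) Σ a_N z^N for all N ≥ 50; the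
-- coefficients below 50 are computed directly.

open import Defs
open import Data.Bool using (Bool; true; false; _∧_; _∨_; not; if_then_else_)
open import Data.Bool.ListAction using (and)
open import Data.Bool.Properties using (∧-assoc; ∧-comm; ∧-identityʳ; ∧-zeroʳ; T-≡) renaming (_≟_ to _≟ᵇ_)
open import Data.Fin using (Fin; #_)
import Data.Fin.Properties as Fin
open import Data.Integer as ℤ using (ℤ; -[1+_])
import Data.Integer.Properties as ℤₚ
import Data.Integer.Tactic.RingSolver as ℤ-Solver
open import Data.List as List using (List; []; _∷_; _++_; map; concatMap; length; filterᵇ; upTo; applyUpTo; foldr)
open import Data.List.Properties as List
  using (map-++; map-∘; map-cong; map-cong-local; concatMap-cong; map-applyUpTo; map-upTo)
open import Data.List.Relation.Binary.Pointwise using (Pointwise; []; _∷_)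
import Data.List.Relation.Binary.Pointwise.Properties as Pointwise
open import Data.List.Relation.Unary.All using (All; []; _∷_; all?)
open import Data.List.Relation.Unary.All.Properties using (applyUpTo⁺₁; applyUpTo⁻; all⁺)
open import Data.Nat
  using (ℕ; zero; suc; pred; _+_; _*_; _∸_; _≡ᵇ_; _≤ᵇ_; _<ᵇ_; _≤_; _<_; s≤s; z≤n; _%_; _/_)
open import Data.Nat.DivMod using (m*n%n≡0; m*n/n≡m; [m+kn]%n≡m%n)
open import Data.Nat.ListAction using (sum)
open import Data.Nat.ListAction.Properties using (sum-++)
open import Data.Nat.Properties
  using (_≟_; _<?_; +-assoc; +-suc; +-identityʳ; *-zeroʳ; *-distribˡ-+; *-distribʳ-∸; *-monoˡ-≤;
         +-∸-assoc; ≤-trans; ≤-refl; m≤m+n; ≮⇒≥; m+[n∸m]≡n)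
open import Data.Nat.Tactic.RingSolver using (solve-∀)
open import Data.Product using (_×_; _,_; proj₁)
open import Data.Vec as Vec using (Vec; []; _∷_; toList; zipWith; lookup; replicate)
open import Data.Vec.Properties as Vec using (lookup-replicate; lookup-map; lookup-zipWith)
open import Function using (_∘_; id; Equivalence)
open import Relation.Binary.PropositionalEquality
open import Relation.Nullary using (Dec; yes; no)
open import Relation.Nullary.Decidable using (toWitness; _×-dec_)


∑ : {A : Set} → List A → (A → ℕ) → ℕ
∑ xs f = sum (map f xs)

∑-++ : {A : Set} (xs ys : List A) (f : A → ℕ) → ∑ (xs ++ ys) f ≡ ∑ xs f + ∑ ys f
∑-++ xs ys f = trans (cong sum (map-++ f xs ys)) (sum-++ (map f xs) (map f ys))

∑-concatMap : {A B : Set} (g : A → List B) (xs : List A) (f : B → ℕ) →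
  ∑ (concatMap g xs) f ≡ ∑ xs (λ x → ∑ (g x) f)
∑-concatMap g []       f = refl
∑-concatMap g (x ∷ xs) f = trans (∑-++ (g x) (concatMap g xs) f) (cong (∑ (g x) f +_) (∑-concatMap g xs f))

∑-map : {A B : Set} (h : A → B) (xs : List A) (f : B → ℕ) → ∑ (map h xs) f ≡ ∑ xs (f ∘ h)
∑-map h xs f = cong sum (sym (map-∘ xs))

∑-cong : {A : Set} (xs : List A) {f g : A → ℕ} → (∀ x → f x ≡ g x) → ∑ xs f ≡ ∑ xs g
∑-cong xs eq = cong sum (map-cong eq xs)

∑-cong-< : (n : ℕ) {f g : ℕ → ℕ} → (∀ {i} → i < n → f i ≡ g i) → ∑ (upTo n) f ≡ ∑ (upTo n) g
∑-cong-< n eq = cong sum (map-cong-local (applyUpTo⁺₁ id n eq))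

∑-zero : {A : Set} (xs : List A) {f : A → ℕ} → (∀ x → f x ≡ 0) → ∑ xs f ≡ 0
∑-zero []       eq = refl
∑-zero (x ∷ xs) eq = cong₂ _+_ (eq x) (∑-zero xs eq)

∑-distrib-+ : {A : Set} (xs : List A) (f g : A → ℕ) → ∑ xs (λ x → f x + g x) ≡ ∑ xs f + ∑ xs g
∑-distrib-+ []       f g = refl
∑-distrib-+ (x ∷ xs) f g = trans (cong (f x + g x +_) (∑-distrib-+ xs f g)) (interchange (f x) (g x) _ _)
  where
  interchange : ∀ a b c d → a + b + (c + d) ≡ a + c + (b + d)
  interchange = solve-∀

∑-comm : {A B : Set} (xs : List A) (ys : List B) (f : A → B → ℕ) →
  ∑ xs (λ x → ∑ ys (f x)) ≡ ∑ ys (λ y → ∑ xs (λ x → f x y))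
∑-comm []       ys f = sym (∑-zero ys (λ _ → refl))
∑-comm (x ∷ xs) ys f = trans (cong (∑ ys (f x) +_) (∑-comm xs ys f))
                             (sym (∑-distrib-+ ys (f x) (λ y → ∑ xs (λ x′ → f x′ y))))

*-distribˡ-∑ : {A : Set} (c : ℕ) (xs : List A) (f : A → ℕ) → c * ∑ xs f ≡ ∑ xs (λ x → c * f x)
*-distribˡ-∑ c []       f = *-zeroʳ c
*-distribˡ-∑ c (x ∷ xs) f = trans (*-distribˡ-+ c (f x) (∑ xs f)) (cong (c * f x +_) (*-distribˡ-∑ c xs f))

∑-upTo-+ : (f : ℕ → ℕ) (m n : ℕ) → ∑ (upTo (m + n)) f ≡ ∑ (upTo m) f + ∑ (upTo n) (λ i → f (m + i))
∑-upTo-+ f m n = begin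
  ∑ (upTo (m + n)) f                                         ≡⟨ cong sum (map-upTo f (m + n)) ⟩
  sum (applyUpTo f (m + n))                                  ≡⟨ split f m ⟩
  sum (applyUpTo f m) + sum (applyUpTo (λ i → f (m + i)) n)
    ≡⟨ cong₂ _+_ (cong sum (map-upTo f m)) (cong sum (map-upTo (λ i → f (m + i)) n)) ⟨
  ∑ (upTo m) f + ∑ (upTo n) (λ i → f (m + i))                ∎
  where
  open ≡-Reasoning
  split : (f : ℕ → ℕ) (m : ℕ) →
    sum (applyUpTo f (m + n)) ≡ sum (applyUpTo f m) + sum (applyUpTo (λ i → f (m + i)) n)
  split f zero    = refl
  split f (suc m) = trans (cong (λ x → f 0 + x) (split (f ∘ suc) m)) (sym (+-assoc (f 0) _ _))

∑-upTo-*2 : (f : ℕ → ℕ) (n : ℕ) →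
  ∑ (upTo (n * 2)) f ≡ ∑ (upTo n) (λ i → f (i * 2)) + ∑ (upTo n) (λ i → f (suc (i * 2)))
∑-upTo-*2 f n = begin
  ∑ (upTo (n * 2)) f                                    ≡⟨ cong sum (map-upTo f (n * 2)) ⟩
  sum (applyUpTo f (n * 2))                             ≡⟨ split f n ⟩
  sum (applyUpTo (λ i → f (i * 2)) n) + sum (applyUpTo (λ i → f (suc (i * 2))) n)
    ≡⟨ cong₂ _+_ (cong sum (map-upTo (λ i → f (i * 2)) n)) (cong sum (map-upTo (λ i → f (suc (i * 2))) n)) ⟨
  ∑ (upTo n) (λ i → f (i * 2)) + ∑ (upTo n) (λ i → f (suc (i * 2))) ∎
  where
  open ≡-Reasoning
  interleave : ∀ x y E O → x + (y + (E + O)) ≡ x + E + (y + O)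
  interleave = solve-∀
  split : (f : ℕ → ℕ) (n : ℕ) →
    sum (applyUpTo f (n * 2)) ≡ sum (applyUpTo (λ i → f (i * 2)) n) + sum (applyUpTo (λ i → f (suc (i * 2))) n)
  split f zero    = refl
  split f (suc n) = trans (cong (λ x → f 0 + (f 1 + x)) (split (f ∘ suc ∘ suc) n)) (interleave (f 0) (f 1) _ _)

length-filterᵇ : {A : Set} (p : A → Bool) (xs : List A) → length (filterᵇ p xs) ≡ ∑ xs (b2n ∘ p)
length-filterᵇ p []       = refl
length-filterᵇ p (x ∷ xs) with p x
... | true  = cong suc (length-filterᵇ p xs)
... | false = length-filterᵇ p xs

∑-filterᵇ : {A : Set} (q : A → Bool) (xs : List A) (f : A → ℕ) → (∀ x → q x ≡ false → f x ≡ 0) →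
  ∑ xs f ≡ ∑ (filterᵇ q xs) f
∑-filterᵇ q []       f out = refl
∑-filterᵇ q (x ∷ xs) f out with q x in qx
... | true  = cong (f x +_) (∑-filterᵇ q xs f out)
... | false = trans (cong (_+ ∑ xs f) (out x qx)) (∑-filterᵇ q xs f out)

∑-Pointwise : {A B : Set} {R : A → B → Set} {xs : List A} {ys : List B} (f : A → ℕ) (g : B → ℕ) →
  (∀ {x y} → R x y → f x ≡ g y) → Pointwise R xs ys → ∑ xs f ≡ ∑ ys g
∑-Pointwise f g fR≡g []           = refl
∑-Pointwise f g fR≡g (Rxy ∷ Rxys) = cong₂ _+_ (fR≡g Rxy) (∑-Pointwise f g fR≡g Rxys)

∑-b2n-∧ : {A : Set} (xs : List A) (b : Bool) (p : A → Bool) →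
  ∑ xs (λ x → b2n (b ∧ p x)) ≡ (if b then ∑ xs (b2n ∘ p) else 0)
∑-b2n-∧ xs true  p = refl
∑-b2n-∧ xs false p = ∑-zero xs (λ _ → refl)

sum-∷ʳ : (xs : List ℕ) (x : ℕ) → sum (xs ++ x ∷ []) ≡ sum xs + x
sum-∷ʳ xs x = trans (sum-++ xs (x ∷ [])) (cong (sum xs +_) (+-identityʳ x))

and-++ : (xs ys : List Bool) → and (xs ++ ys) ≡ and xs ∧ and ys
and-++ []           ys = refl
and-++ (true  ∷ xs) ys = and-++ xs ys
and-++ (false ∷ xs) ys = refl

and-concatMap-∷ : {A : Set} (x : A → Bool) (ys : A → List Bool) (l : List A) →
  and (concatMap (λ r → x r ∷ ys r) l) ≡ and (map x l) ∧ and (concatMap ys l)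
and-concatMap-∷ x ys []      = refl
and-concatMap-∷ x ys (r ∷ l) with x r
... | false = refl
... | true  = trans (and-++ (ys r) _) (trans (cong (and (ys r) ∧_) (and-concatMap-∷ x ys l))
                (trans (sym (∧-assoc (and (ys r)) _ _))
                (trans (cong (_∧ and (concatMap ys l)) (∧-comm (and (ys r)) (and (map x l))))
                (trans (∧-assoc (and (map x l)) _ _) (cong (and (map x l) ∧_) (sym (and-++ (ys r) _)))))))

and-map-upTo⁻ : (f : ℕ → Bool) (m : ℕ) → and (map f (upTo m)) ≡ true → ∀ {r} → r < m → f r ≡ true
and-map-upTo⁻ f m ok r<m =
  Equivalence.to T-≡ (applyUpTo⁻ id m (all⁺ f (upTo m) (Equivalence.from T-≡ ok)) r<m)

and-map-mono : {A : Set} {f g : A → Bool} (xs : List A) → (∀ x → f x ≡ true → g x ≡ true) →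
  and (map f xs) ≡ true → and (map g xs) ≡ true
and-map-mono         []       f⇒g ok = refl
and-map-mono {f = f} (x ∷ xs) f⇒g ok with f x in fx
... | true rewrite f⇒g x fx = and-map-mono xs f⇒g ok

map-upTo-suc : {B : Set} (f : ℕ → B) (n : ℕ) → map f (upTo (suc n)) ≡ f 0 ∷ map (f ∘ suc) (upTo n)
map-upTo-suc f n = cong (f 0 ∷_) (trans (map-applyUpTo suc f n) (sym (map-applyUpTo id (f ∘ suc) n)))

-- Tilings of a rectangle whose cells may be precovered from outside

Marking : Set
Marking = ℕ → ℕ → Mark

-- E r c is the number of tiles lying outside the rectangle that cover cell (r , c).
Precover : Set
Precover = ℕ → ℕ → ℕ

noPrecover : Precover
noPrecover _ _ = 0

horCover verCover : Marking → ℕ → ℕ → ℕ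
horCover M r c = sum (map (λ k → b2n ((k ≤ᵇ c) ∧ isHor (M r (c ∸ k)))) (upTo 4))
verCover M r c = sum (map (λ k → b2n ((k ≤ᵇ r) ∧ isVer (M (r ∸ k) c))) (upTo 4))

fitsIn : ℕ → ℕ → ℕ → ℕ → Mark → Bool
fitsIn m n r c none = true
fitsIn m n r c hor  = c + 4 ≤ᵇ n
fitsIn m n r c ver  = r + 4 ≤ᵇ m

cellOK : ℕ → ℕ → Marking → Precover → ℕ → ℕ → Bool
cellOK m n M E r c = fitsIn m n r c (M r c) ∧ (horCover M r c + verCover M r c + E r c ≡ᵇ 1)

tilesWith : ℕ → ℕ → Marking → Precover → Bool
tilesWith m n M E = and (concatMap (λ r → map (cellOK m n M E r) (upTo n)) (upTo m))

anchorFits≡fitsIn : {m n : ℕ} (g : Grid m n) (r c : ℕ) → anchorFits g r c ≡ fitsIn m n r c (markAt g r c)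
anchorFits≡fitsIn g r c with markAt g r c
... | none = refl
... | hor  = refl
... | ver  = refl

isTiling≡tilesWith : {m n : ℕ} (g : Grid m n) → isTiling g ≡ tilesWith m n (markAt g) noPrecover
isTiling≡tilesWith {m} {n} g = cong and (concatMap-cong (λ r → map-cong (λ c → cong₂ _∧_
  (anchorFits≡fitsIn g r c)
  (cong (_≡ᵇ 1) (trans (∑-distrib-+ (upTo 4) (λ k → b2n ((k ≤ᵇ c) ∧ isHor (markAt g r (c ∸ k))))
                                                (λ k → b2n ((k ≤ᵇ r) ∧ isVer (markAt g (r ∸ k) c))))
                           (sym (+-identityʳ _))))) (upTo n)) (upTo m))

tilesWith-cong : (m n : ℕ) {M M′ : Marking} {E E′ : Precover} →
  (∀ r c → M r c ≡ M′ r c) → (∀ r c → E r c ≡ E′ r c) → tilesWith m n M E ≡ tilesWith m n M′ E′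
tilesWith-cong m n eqM eqE = cong and (concatMap-cong (λ r → map-cong (λ c → cong₂ _∧_
  (cong (fitsIn m n r c) (eqM r c))
  (cong (_≡ᵇ 1) (cong₂ _+_ (cong₂ _+_
    (cong sum (map-cong (λ k → cong (λ x → b2n ((k ≤ᵇ c) ∧ isHor x)) (eqM r (c ∸ k))) (upTo 4)))
    (cong sum (map-cong (λ k → cong (λ x → b2n ((k ≤ᵇ r) ∧ isVer x)) (eqM (r ∸ k) c)) (upTo 4))))
    (eqE r c)))) (upTo n)) (upTo m))

infixr 5 _◂_
_◂_ : (ℕ → Mark) → Marking → Marking
(col ◂ M) r zero    = col r
(col ◂ M) r (suc c) = M r c

-- Once the first column col is cut off, a horizontal tile anchored in it still
-- covers the first three columns of what remains.
restPrecover : Precover → (ℕ → Mark) → Precover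
restPrecover E col r c = E r (suc c) + b2n ((c <ᵇ 3) ∧ isHor (col r))

horCover-◂ : (col : ℕ → Mark) (M : Marking) (r c : ℕ) →
  horCover (col ◂ M) r (suc c) ≡ horCover M r c + b2n ((c <ᵇ 3) ∧ isHor (col r))
horCover-◂ col M r 0 = sum-∷ʳ (h 0 ∷ []) (b2n (isHor (col r)))
  where h = λ c → b2n (isHor (M r c))
horCover-◂ col M r 1 = sum-∷ʳ (h 1 ∷ h 0 ∷ []) (b2n (isHor (col r)))
  where h = λ c → b2n (isHor (M r c))
horCover-◂ col M r 2 = sum-∷ʳ (h 2 ∷ h 1 ∷ h 0 ∷ []) (b2n (isHor (col r)))
  where h = λ c → b2n (isHor (M r c))
horCover-◂ col M r (suc (suc (suc c))) = sym (+-identityʳ _)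

fitsIn-suc : (m n r c : ℕ) (x : Mark) → fitsIn m (suc n) r (suc c) x ≡ fitsIn m n r c x
fitsIn-suc m n r c none = refl
fitsIn-suc m n r c hor  = suc≤ᵇsuc (c + 4) n
  where
  suc≤ᵇsuc : ∀ a b → (suc a ≤ᵇ suc b) ≡ (a ≤ᵇ b)
  suc≤ᵇsuc zero    b = refl
  suc≤ᵇsuc (suc a) b = refl
fitsIn-suc m n r c ver  = refl

cellOK-◂ : (m n : ℕ) (col : ℕ → Mark) (M : Marking) (E : Precover) (r c : ℕ) →
  cellOK m (suc n) (col ◂ M) E r (suc c) ≡ cellOK m n M (restPrecover E col) r c
cellOK-◂ m n col M E r c = cong₂ _∧_ (fitsIn-suc m n r c (M r c)) (cong (_≡ᵇ 1)
  (trans (cong (λ h → h + verCover M r c + E r (suc c)) (horCover-◂ col M r c))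
         (move (horCover M r c) (b2n ((c <ᵇ 3) ∧ isHor (col r))) (verCover M r c) (E r (suc c)))))
  where
  move : ∀ h x v e → h + x + v + e ≡ h + v + (e + x)
  move = solve-∀

firstColumnOK : ℕ → ℕ → Precover → (ℕ → Mark) → Bool
firstColumnOK m n E col = and (map (λ r → cellOK m (suc n) (col ◂ λ _ _ → none) E r 0) (upTo m))

tilesWith-◂ : (m n : ℕ) (col : ℕ → Mark) (M : Marking) (E : Precover) →
  tilesWith m (suc n) (col ◂ M) E ≡ firstColumnOK m n E col ∧ tilesWith m n M (restPrecover E col)
tilesWith-◂ m n col M E = begin
  and (concatMap (λ r → map (cell r) (upTo (suc n))) (upTo m))
    ≡⟨ cong and (concatMap-cong (λ r → map-upTo-suc (cell r) n) (upTo m)) ⟩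
  and (concatMap (λ r → cell r 0 ∷ map (cell r ∘ suc) (upTo n)) (upTo m))
    ≡⟨ and-concatMap-∷ (λ r → cell r 0) (λ r → map (cell r ∘ suc) (upTo n)) (upTo m) ⟩
  firstColumnOK m n E col ∧ and (concatMap (λ r → map (cell r ∘ suc) (upTo n)) (upTo m))
    ≡⟨ cong (firstColumnOK m n E col ∧_) (cong and (concatMap-cong (λ r →
         map-cong (cellOK-◂ m n col M E r) (upTo n)) (upTo m))) ⟩
  firstColumnOK m n E col ∧ tilesWith m n M (restPrecover E col) ∎
  where
  open ≡-Reasoning
  cell = cellOK m (suc n) (col ◂ M) E

firstColumnOK-mono : (m n : ℕ) (E : Precover) (col : ℕ → Mark) →
  firstColumnOK m n E col ≡ true → firstColumnOK m 3 E col ≡ true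
firstColumnOK-mono m n E col = and-map-mono (upTo m) (λ r → ∧-monoˡ (fitsIn-mono r (col r)))
  where
  fitsIn-mono : ∀ r x → fitsIn m (suc n) r 0 x ≡ true → fitsIn m 4 r 0 x ≡ true
  fitsIn-mono r none fits = refl
  fitsIn-mono r hor  fits = refl
  fitsIn-mono r ver  fits = fits
  ∧-monoˡ : ∀ {a a′ b} → (a ≡ true → a′ ≡ true) → a ∧ b ≡ true → a′ ∧ b ≡ true
  ∧-monoˡ {true} a⇒a′ ok rewrite a⇒a′ refl = ok

firstColumnOK-wide : (m n : ℕ) (E : Precover) (col : ℕ → Mark) →
  firstColumnOK m (3 + n) E col ≡ firstColumnOK m 3 E col
firstColumnOK-wide m n E col = cong and (map-cong (λ r → cong (_∧ _) (fitsIn-wide r (col r))) (upTo m))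
  where
  fitsIn-wide : ∀ r x → fitsIn m (4 + n) r 0 x ≡ fitsIn m 4 r 0 x
  fitsIn-wide r none = refl
  fitsIn-wide r hor  = refl
  fitsIn-wide r ver  = refl

tilingCount : ℕ → ℕ → Precover → ℕ
tilingCount m n E = ∑ (allGrids m n) (λ g → b2n (tilesWith m n (markAt g) E))

numTilings≡tilingCount : (m n : ℕ) → numTilings m n ≡ tilingCount m n noPrecover
numTilings≡tilingCount m n = trans (length-filterᵇ isTiling (allGrids m n))
  (∑-cong (allGrids m n) (λ g → cong b2n (isTiling≡tilesWith g)))

tilingCount-cong : (m n : ℕ) {E E′ : Precover} → (∀ r c → E r c ≡ E′ r c) →
  tilingCount m n E ≡ tilingCount m n E′
tilingCount-cong m n eq =
  ∑-cong (allGrids m n) (λ g → cong b2n (tilesWith-cong m n {markAt g} (λ _ _ → refl) eq))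

allVecs-singleton : {A : Set} (x : A) (m : ℕ) → allVecs (x ∷ []) m ≡ replicate m x ∷ []
allVecs-singleton x zero    = refl
allVecs-singleton x (suc m) rewrite allVecs-singleton x m = refl

concatMap-const-[] : {A B : Set} (xs : List A) → concatMap (λ _ → []) xs ≡ ([] {A = B})
concatMap-const-[] []       = refl
concatMap-const-[] (x ∷ xs) = concatMap-const-[] xs

tilingCount-zero : (m : ℕ) (E : Precover) → tilingCount m 0 E ≡ 1
tilingCount-zero m E rewrite allVecs-singleton {A = Vec Mark 0} [] m
                           | concatMap-const-[] {B = Bool} (upTo m) = refl

∑-allVecs-suc : {A : Set} (X : List A) (n : ℕ) (f : Vec A (suc n) → ℕ) →
  ∑ (allVecs X (suc n)) f ≡ ∑ X (λ x → ∑ (allVecs X n) (λ v → f (x ∷ v)))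
∑-allVecs-suc X n f = trans (∑-concatMap _ X f) (∑-cong X (λ x → ∑-map (x ∷_) (allVecs X n) f))

∑-grid-firstColumn : {A : Set} (X : List A) (m n : ℕ) (f : Vec (Vec A (suc n)) m → ℕ) →
  ∑ (allVecs (allVecs X (suc n)) m) f ≡
  ∑ (allVecs X m) (λ col → ∑ (allVecs (allVecs X n) m) (λ g → f (zipWith _∷_ col g)))
∑-grid-firstColumn X zero    n f = sym (+-identityʳ _)
∑-grid-firstColumn X (suc m) n f = begin
  ∑ (allVecs (allVecs X (suc n)) (suc m)) f
    ≡⟨ ∑-allVecs-suc (allVecs X (suc n)) m f ⟩
  ∑ (allVecs X (suc n)) (λ row → ∑ grids′ (λ g → f (row ∷ g)))
    ≡⟨ ∑-allVecs-suc X n _ ⟩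
  ∑ X (λ x → ∑ rows (λ row → ∑ grids′ (λ g → f ((x ∷ row) ∷ g))))
    ≡⟨ ∑-cong X (λ x → ∑-cong rows (λ row → ∑-grid-firstColumn X m n (λ g → f ((x ∷ row) ∷ g)))) ⟩
  ∑ X (λ x → ∑ rows (λ row → ∑ (allVecs X m) (λ col → ∑ grids (λ g → f ((x ∷ row) ∷ zipWith _∷_ col g)))))
    ≡⟨ ∑-cong X (λ x → ∑-comm rows (allVecs X m) _) ⟩
  ∑ X (λ x → ∑ (allVecs X m) (λ col → ∑ rows (λ row → ∑ grids (λ g → f ((x ∷ row) ∷ zipWith _∷_ col g)))))
    ≡⟨ ∑-cong X (λ x → ∑-cong (allVecs X m) (λ col →
         sym (∑-allVecs-suc rows m (λ g → f (zipWith _∷_ (x ∷ col) g))))) ⟩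
  ∑ X (λ x → ∑ (allVecs X m) (λ col → ∑ (allVecs rows (suc m)) (λ g → f (zipWith _∷_ (x ∷ col) g))))
    ≡⟨ sym (∑-allVecs-suc X m _) ⟩
  ∑ (allVecs X (suc m)) (λ col → ∑ (allVecs rows (suc m)) (λ g → f (zipWith _∷_ col g))) ∎
  where
  open ≡-Reasoning
  rows = allVecs X n
  grids = allVecs rows m
  grids′ = allVecs (allVecs X (suc n)) m

column : {m : ℕ} → Vec Mark m → ℕ → Mark
column col = nth none (toList col)

markAt-zipWith : {m n : ℕ} (col : Vec Mark m) (g : Grid m n) (r c : ℕ) →
  markAt (zipWith _∷_ col g) r c ≡ (column col ◂ markAt g) r c
markAt-zipWith []        []      r       zero    = refl
markAt-zipWith []        []      r       (suc c) = refl
markAt-zipWith (x ∷ col) (_ ∷ g) zero    zero    = refl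
markAt-zipWith (x ∷ col) (_ ∷ g) zero    (suc c) = refl
markAt-zipWith (x ∷ col) (_ ∷ g) (suc r) zero    = markAt-zipWith col g r zero
markAt-zipWith (x ∷ col) (_ ∷ g) (suc r) (suc c) = markAt-zipWith col g r (suc c)

tilingCount-suc : (m n : ℕ) (E : Precover) → tilingCount m (suc n) E ≡
  ∑ (allVecs allMarks m) (λ col →
    if firstColumnOK m n E (column col) then tilingCount m n (restPrecover E (column col)) else 0)
tilingCount-suc m n E =
  trans (∑-grid-firstColumn allMarks m n (λ g → b2n (tilesWith m (suc n) (markAt g) E)))
  (∑-cong (allVecs allMarks m) (λ col →
    trans (∑-cong (allGrids m n) (λ g → cong b2n
            (trans (tilesWith-cong m (suc n) (markAt-zipWith col g) (λ _ _ → refl))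
                   (tilesWith-◂ m n (column col) (markAt g) E))))
          (∑-b2n-∧ (allGrids m n) (firstColumnOK m n E (column col))
                   (λ g → tilesWith m n (markAt g) (restPrecover E (column col))))))

-- Overhang profiles

-- Entry r is the overhang of row r: how many of its leading cells are covered
-- by a horizontal tile anchored further left.
Profile : Set
Profile = List ℕ

profilePrecover : Profile → Precover
profilePrecover s r c = b2n (c <ᵇ nth 0 s r)

nextOverhang : ℕ → Mark → ℕ
nextOverhang x mk = if isHor mk then 3 else pred x

nextProfile : Profile → List Mark → Profile
nextProfile []       []       = []
nextProfile []       (k ∷ ks) = nextOverhang 0 k ∷ nextProfile [] ks
nextProfile (x ∷ xs) []       = nextOverhang x none ∷ nextProfile xs []
nextProfile (x ∷ xs) (k ∷ ks) = nextOverhang x k ∷ nextProfile xs ks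

nth-nextProfile : (s : Profile) (ks : List Mark) (r : ℕ) →
  nth 0 (nextProfile s ks) r ≡ nextOverhang (nth 0 s r) (nth none ks r)
nth-nextProfile []      []       r       = refl
nth-nextProfile []      (k ∷ ks) zero    = refl
nth-nextProfile []      (k ∷ ks) (suc r) = nth-nextProfile [] ks r
nth-nextProfile (x ∷ s) []       zero    = refl
nth-nextProfile (x ∷ s) []       (suc r) = nth-nextProfile s [] r
nth-nextProfile (x ∷ s) (k ∷ ks) zero    = refl
nth-nextProfile (x ∷ s) (k ∷ ks) (suc r) = nth-nextProfile s ks r

restPrecover-overhang : (x : ℕ) (mk : Mark) (k : ℕ) → (mk ≡ hor → x ≡ 0) →
  b2n (suc k <ᵇ x) + b2n ((k <ᵇ 3) ∧ isHor mk) ≡ b2n (k <ᵇ nextOverhang x mk)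
restPrecover-overhang x       hor  k hor⇒0 rewrite hor⇒0 refl | ∧-identityʳ (k <ᵇ 3) = refl
restPrecover-overhang zero    none k _ rewrite ∧-zeroʳ (k <ᵇ 3) = refl
restPrecover-overhang (suc x) none k _ rewrite ∧-zeroʳ (k <ᵇ 3) = +-identityʳ _
restPrecover-overhang zero    ver  k _ rewrite ∧-zeroʳ (k <ᵇ 3) = refl
restPrecover-overhang (suc x) ver  k _ rewrite ∧-zeroʳ (k <ᵇ 3) = +-identityʳ _

column-hor⇒< : {m : ℕ} (col : Vec Mark m) (r : ℕ) → column col r ≡ hor → r < m
column-hor⇒< (x ∷ col) zero    _  = s≤s z≤n
column-hor⇒< (x ∷ col) (suc r) eq = s≤s (column-hor⇒< col r eq)

hor-anchor⇒no-overhang : (m n : ℕ) (M : Marking) (s : Profile) (r : ℕ) → M r 0 ≡ hor →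
  cellOK m n M (profilePrecover s) r 0 ≡ true → nth 0 s r ≡ 0
hor-anchor⇒no-overhang m n M s r anchor ok =
  overhang-zero (verCover M r 0) (nth 0 s r) (cong (λ mk → b2n (isHor mk) + 0) anchor) (∧-elimʳ ok)
  where
  ∧-elimʳ : ∀ {a b} → a ∧ b ≡ true → b ≡ true
  ∧-elimʳ {true} eq = eq
  overhang-zero : ∀ {h} v x → h ≡ 1 → (h + v + b2n (0 <ᵇ x) ≡ᵇ 1) ≡ true → x ≡ 0
  overhang-zero zero    zero    refl _ = refl
  overhang-zero zero    (suc x) refl ()
  overhang-zero (suc v) x       refl ()

restPrecover≡nextProfile : (m n : ℕ) (s : Profile) (col : Vec Mark m) →
  firstColumnOK m n (profilePrecover s) (column col) ≡ true →
  ∀ r k → restPrecover (profilePrecover s) (column col) r k ≡ profilePrecover (nextProfile s (toList col)) r k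
restPrecover≡nextProfile m n s col ok r k rewrite nth-nextProfile s (toList col) r =
  restPrecover-overhang (nth 0 s r) (column col r) k (λ anchor →
    hor-anchor⇒no-overhang m (suc n) (column col ◂ λ _ _ → none) s r anchor
      (and-map-upTo⁻ _ m ok (column-hor⇒< col r anchor)))

-- The transfer map for eight rows

Column : Set
Column = Vec Mark 8

fitsFirst : ℕ → Profile → Column → Bool
fitsFirst n s col = firstColumnOK 8 n (profilePrecover s) (column col)

profileCount : Profile → ℕ → ℕ
profileCount s n = tilingCount 8 n (profilePrecover s)

profileCount-suc : (s : Profile) (n : ℕ) → profileCount s (suc n) ≡
  ∑ (allVecs allMarks 8) (λ col → if fitsFirst n s col then profileCount (nextProfile s (toList col)) n else 0)
profileCount-suc s n = trans (tilingCount-suc 8 n (profilePrecover s))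
  -- the summands are explicit: inferring them would evaluate the sum over all 3^8 columns
  (∑-cong (allVecs allMarks 8)
     {λ col → if fitsFirst n s col then tilingCount 8 n (restPrecover (profilePrecover s) (column col)) else 0}
     {λ col → if fitsFirst n s col then profileCount (nextProfile s (toList col)) n else 0}
     (λ col → next (fitsFirst n s col) refl))
  where
  next : ∀ {col} b → fitsFirst n s col ≡ b →
    (if b then tilingCount 8 n (restPrecover (profilePrecover s) (column col)) else 0) ≡
    (if b then profileCount (nextProfile s (toList col)) n else 0)
  next {col} true  ok = tilingCount-cong 8 n (restPrecover≡nextProfile 8 n s col ok)
  next       false _  = refl

admissibleColumns : Profile → List Column
admissibleColumns s = filterᵇ (fitsFirst 3 s) (allVecs allMarks 8)

profileCount-admissible : (s : Profile) (n : ℕ) → profileCount s (suc n) ≡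
  ∑ (admissibleColumns s) (λ col → if fitsFirst n s col then profileCount (nextProfile s (toList col)) n else 0)
profileCount-admissible s n = trans (profileCount-suc s n) (∑-filterᵇ (fitsFirst 3 s) (allVecs allMarks 8)
  (λ col → if fitsFirst n s col then profileCount (nextProfile s (toList col)) n else 0) vanish)
  where
  vanish : ∀ col → fitsFirst 3 s col ≡ false →
    (if fitsFirst n s col then profileCount (nextProfile s (toList col)) n else 0) ≡ 0
  vanish col narrow with fitsFirst n s col in fits
  ... | false = refl
  ... | true  with () ← trans (sym narrow) (firstColumnOK-mono 8 n (profilePrecover s) (column col) fits)

-- The profiles reachable from the empty one.  For each of them, transitions lists
-- the admissible columns in order: the index of the profile they lead to, and
-- whether they anchor a horizontal tile, which needs three more columns.
profiles : Vec Profile 52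
profiles =
  (0 ∷ 0 ∷ 0 ∷ 0 ∷ 0 ∷ 0 ∷ 0 ∷ 0 ∷ [])
  ∷ (3 ∷ 3 ∷ 3 ∷ 3 ∷ 3 ∷ 3 ∷ 3 ∷ 3 ∷ [])
  ∷ (3 ∷ 3 ∷ 3 ∷ 3 ∷ 0 ∷ 0 ∷ 0 ∷ 0 ∷ [])
  ∷ (3 ∷ 3 ∷ 3 ∷ 0 ∷ 0 ∷ 0 ∷ 0 ∷ 3 ∷ [])
  ∷ (3 ∷ 3 ∷ 0 ∷ 0 ∷ 0 ∷ 0 ∷ 3 ∷ 3 ∷ [])
  ∷ (3 ∷ 0 ∷ 0 ∷ 0 ∷ 0 ∷ 3 ∷ 3 ∷ 3 ∷ [])
  ∷ (0 ∷ 0 ∷ 0 ∷ 0 ∷ 3 ∷ 3 ∷ 3 ∷ 3 ∷ [])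
  ∷ (2 ∷ 2 ∷ 2 ∷ 2 ∷ 2 ∷ 2 ∷ 2 ∷ 2 ∷ [])
  ∷ (2 ∷ 2 ∷ 2 ∷ 2 ∷ 3 ∷ 3 ∷ 3 ∷ 3 ∷ [])
  ∷ (2 ∷ 2 ∷ 2 ∷ 2 ∷ 0 ∷ 0 ∷ 0 ∷ 0 ∷ [])
  ∷ (2 ∷ 2 ∷ 2 ∷ 3 ∷ 3 ∷ 3 ∷ 3 ∷ 2 ∷ [])
  ∷ (2 ∷ 2 ∷ 2 ∷ 0 ∷ 0 ∷ 0 ∷ 0 ∷ 2 ∷ [])
  ∷ (2 ∷ 2 ∷ 3 ∷ 3 ∷ 3 ∷ 3 ∷ 2 ∷ 2 ∷ [])
  ∷ (2 ∷ 2 ∷ 0 ∷ 0 ∷ 0 ∷ 0 ∷ 2 ∷ 2 ∷ [])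
  ∷ (2 ∷ 3 ∷ 3 ∷ 3 ∷ 3 ∷ 2 ∷ 2 ∷ 2 ∷ [])
  ∷ (2 ∷ 0 ∷ 0 ∷ 0 ∷ 0 ∷ 2 ∷ 2 ∷ 2 ∷ [])
  ∷ (3 ∷ 3 ∷ 3 ∷ 3 ∷ 2 ∷ 2 ∷ 2 ∷ 2 ∷ [])
  ∷ (0 ∷ 0 ∷ 0 ∷ 0 ∷ 2 ∷ 2 ∷ 2 ∷ 2 ∷ [])
  ∷ (1 ∷ 1 ∷ 1 ∷ 1 ∷ 1 ∷ 1 ∷ 1 ∷ 1 ∷ [])
  ∷ (1 ∷ 1 ∷ 1 ∷ 1 ∷ 2 ∷ 2 ∷ 2 ∷ 2 ∷ [])
  ∷ (1 ∷ 1 ∷ 1 ∷ 1 ∷ 3 ∷ 3 ∷ 3 ∷ 3 ∷ [])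
  ∷ (1 ∷ 1 ∷ 1 ∷ 1 ∷ 0 ∷ 0 ∷ 0 ∷ 0 ∷ [])
  ∷ (1 ∷ 1 ∷ 1 ∷ 2 ∷ 2 ∷ 2 ∷ 2 ∷ 1 ∷ [])
  ∷ (1 ∷ 1 ∷ 1 ∷ 3 ∷ 3 ∷ 3 ∷ 3 ∷ 1 ∷ [])
  ∷ (1 ∷ 1 ∷ 1 ∷ 0 ∷ 0 ∷ 0 ∷ 0 ∷ 1 ∷ [])
  ∷ (1 ∷ 1 ∷ 2 ∷ 2 ∷ 2 ∷ 2 ∷ 1 ∷ 1 ∷ [])
  ∷ (1 ∷ 1 ∷ 3 ∷ 3 ∷ 3 ∷ 3 ∷ 1 ∷ 1 ∷ [])
  ∷ (1 ∷ 1 ∷ 0 ∷ 0 ∷ 0 ∷ 0 ∷ 1 ∷ 1 ∷ [])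
  ∷ (1 ∷ 2 ∷ 2 ∷ 2 ∷ 2 ∷ 1 ∷ 1 ∷ 1 ∷ [])
  ∷ (1 ∷ 3 ∷ 3 ∷ 3 ∷ 3 ∷ 1 ∷ 1 ∷ 1 ∷ [])
  ∷ (1 ∷ 0 ∷ 0 ∷ 0 ∷ 0 ∷ 1 ∷ 1 ∷ 1 ∷ [])
  ∷ (2 ∷ 2 ∷ 2 ∷ 2 ∷ 1 ∷ 1 ∷ 1 ∷ 1 ∷ [])
  ∷ (3 ∷ 3 ∷ 3 ∷ 3 ∷ 1 ∷ 1 ∷ 1 ∷ 1 ∷ [])
  ∷ (0 ∷ 0 ∷ 0 ∷ 0 ∷ 1 ∷ 1 ∷ 1 ∷ 1 ∷ [])
  ∷ (0 ∷ 0 ∷ 0 ∷ 1 ∷ 1 ∷ 1 ∷ 1 ∷ 0 ∷ [])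
  ∷ (0 ∷ 0 ∷ 0 ∷ 2 ∷ 2 ∷ 2 ∷ 2 ∷ 0 ∷ [])
  ∷ (0 ∷ 0 ∷ 0 ∷ 3 ∷ 3 ∷ 3 ∷ 3 ∷ 0 ∷ [])
  ∷ (0 ∷ 0 ∷ 1 ∷ 1 ∷ 1 ∷ 1 ∷ 0 ∷ 0 ∷ [])
  ∷ (0 ∷ 0 ∷ 2 ∷ 2 ∷ 2 ∷ 2 ∷ 0 ∷ 0 ∷ [])
  ∷ (0 ∷ 0 ∷ 3 ∷ 3 ∷ 3 ∷ 3 ∷ 0 ∷ 0 ∷ [])
  ∷ (0 ∷ 1 ∷ 1 ∷ 1 ∷ 1 ∷ 0 ∷ 0 ∷ 0 ∷ [])
  ∷ (0 ∷ 2 ∷ 2 ∷ 2 ∷ 2 ∷ 0 ∷ 0 ∷ 0 ∷ [])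
  ∷ (0 ∷ 3 ∷ 3 ∷ 3 ∷ 3 ∷ 0 ∷ 0 ∷ 0 ∷ [])
  ∷ (3 ∷ 3 ∷ 3 ∷ 1 ∷ 1 ∷ 1 ∷ 1 ∷ 3 ∷ [])
  ∷ (3 ∷ 3 ∷ 3 ∷ 2 ∷ 2 ∷ 2 ∷ 2 ∷ 3 ∷ [])
  ∷ (3 ∷ 3 ∷ 1 ∷ 1 ∷ 1 ∷ 1 ∷ 3 ∷ 3 ∷ [])
  ∷ (3 ∷ 3 ∷ 2 ∷ 2 ∷ 2 ∷ 2 ∷ 3 ∷ 3 ∷ [])
  ∷ (3 ∷ 1 ∷ 1 ∷ 1 ∷ 1 ∷ 3 ∷ 3 ∷ 3 ∷ [])
  ∷ (3 ∷ 2 ∷ 2 ∷ 2 ∷ 2 ∷ 3 ∷ 3 ∷ 3 ∷ [])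
  ∷ (2 ∷ 2 ∷ 2 ∷ 1 ∷ 1 ∷ 1 ∷ 1 ∷ 2 ∷ [])
  ∷ (2 ∷ 2 ∷ 1 ∷ 1 ∷ 1 ∷ 1 ∷ 2 ∷ 2 ∷ [])
  ∷ (2 ∷ 1 ∷ 1 ∷ 1 ∷ 1 ∷ 2 ∷ 2 ∷ 2 ∷ [])
  ∷ []

transitions : Vec (List (Fin 52 × Bool)) 52
transitions =
  ((# 1 , true) ∷ (# 2 , true) ∷ (# 3 , true) ∷ (# 4 , true) ∷ (# 5 , true) ∷ (# 6 , true) ∷ (# 0 , false) ∷ [])
  ∷ ((# 7 , false) ∷ [])
  ∷ ((# 8 , true) ∷ (# 9 , false) ∷ [])
  ∷ ((# 10 , true) ∷ (# 11 , false) ∷ [])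
  ∷ ((# 12 , true) ∷ (# 13 , false) ∷ [])
  ∷ ((# 14 , true) ∷ (# 15 , false) ∷ [])
  ∷ ((# 16 , true) ∷ (# 17 , false) ∷ [])
  ∷ ((# 18 , false) ∷ [])
  ∷ ((# 19 , false) ∷ [])
  ∷ ((# 20 , true) ∷ (# 21 , false) ∷ [])
  ∷ ((# 22 , false) ∷ [])
  ∷ ((# 23 , true) ∷ (# 24 , false) ∷ [])
  ∷ ((# 25 , false) ∷ [])
  ∷ ((# 26 , true) ∷ (# 27 , false) ∷ [])
  ∷ ((# 28 , false) ∷ [])
  ∷ ((# 29 , true) ∷ (# 30 , false) ∷ [])
  ∷ ((# 31 , false) ∷ [])
  ∷ ((# 32 , true) ∷ (# 33 , false) ∷ [])
  ∷ ((# 0 , false) ∷ [])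
  ∷ ((# 33 , false) ∷ [])
  ∷ ((# 17 , false) ∷ [])
  ∷ ((# 6 , true) ∷ (# 0 , false) ∷ [])
  ∷ ((# 34 , false) ∷ [])
  ∷ ((# 35 , false) ∷ [])
  ∷ ((# 36 , true) ∷ (# 0 , false) ∷ [])
  ∷ ((# 37 , false) ∷ [])
  ∷ ((# 38 , false) ∷ [])
  ∷ ((# 39 , true) ∷ (# 0 , false) ∷ [])
  ∷ ((# 40 , false) ∷ [])
  ∷ ((# 41 , false) ∷ [])
  ∷ ((# 42 , true) ∷ (# 0 , false) ∷ [])
  ∷ ((# 21 , false) ∷ [])
  ∷ ((# 9 , false) ∷ [])
  ∷ ((# 2 , true) ∷ (# 0 , false) ∷ [])
  ∷ ((# 3 , true) ∷ [])
  ∷ ((# 43 , true) ∷ [])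
  ∷ ((# 44 , true) ∷ [])
  ∷ ((# 4 , true) ∷ [])
  ∷ ((# 45 , true) ∷ [])
  ∷ ((# 46 , true) ∷ [])
  ∷ ((# 5 , true) ∷ [])
  ∷ ((# 47 , true) ∷ [])
  ∷ ((# 48 , true) ∷ [])
  ∷ ((# 11 , false) ∷ [])
  ∷ ((# 49 , false) ∷ [])
  ∷ ((# 13 , false) ∷ [])
  ∷ ((# 50 , false) ∷ [])
  ∷ ((# 15 , false) ∷ [])
  ∷ ((# 51 , false) ∷ [])
  ∷ ((# 24 , false) ∷ [])
  ∷ ((# 27 , false) ∷ [])
  ∷ ((# 30 , false) ∷ [])
  ∷ []

widthAllows : ℕ → Bool → Bool
widthAllows n h = (3 ≤ᵇ n) ∨ not h

Transition : Profile → Column → Fin 52 × Bool → Set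
Transition s col (j , h) = nextProfile s (toList col) ≡ lookup profiles j
                         × All (λ n → fitsFirst n s col ≡ widthAllows n h) (upTo 4)

transitions-correct : ∀ i → Pointwise (Transition (lookup profiles i))
                                      (admissibleColumns (lookup profiles i)) (lookup transitions i)
transitions-correct = toWitness {a? = Fin.all? λ i → Pointwise.decidable transition? _ _} _
  where
  transition? : ∀ {s} col t → Dec (Transition s col t)
  transition? {s} col (j , h) = List.≡-dec _≟_ (nextProfile s (toList col)) (lookup profiles j)
                         ×-dec all? (λ n → fitsFirst n s col ≟ᵇ widthAllows n h) (upTo 4)

transfer : ℕ → Vec ℕ 52 → Vec ℕ 52
transfer n v = Vec.map (λ ts → ∑ ts (λ (j , h) → if widthAllows n h then lookup v j else 0)) transitions

-- Opaque, so that the type checker never unfolds it at symbolic widths such as 25 + u.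
opaque
  counts : ℕ → Vec ℕ 52
  counts zero    = replicate 52 1
  counts (suc n) = transfer n (counts n)

opaque
  unfolding counts

  counts-zero : ∀ i → lookup (counts 0) i ≡ 1
  counts-zero i = lookup-replicate i 1

  counts-suc : ∀ n i → lookup (counts (suc n)) i ≡
    ∑ (lookup transitions i) (λ (j , h) → if widthAllows n h then lookup (counts n) j else 0)
  counts-suc n i = lookup-map i (λ ts → ∑ ts (λ (j , h) → if widthAllows n h then lookup (counts n) j else 0)) transitions

tilings8 : ℕ → ℕ
tilings8 n = lookup (counts n) (# 0)

fitsFirst-width : {s : Profile} {col : Column} {h : Bool} →
  All (λ n → fitsFirst n s col ≡ widthAllows n h) (upTo 4) → ∀ n → fitsFirst n s col ≡ widthAllows n h
fitsFirst-width (w₀ ∷ _  ∷ _  ∷ _  ∷ []) 0 = w₀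
fitsFirst-width (_  ∷ w₁ ∷ _  ∷ _  ∷ []) 1 = w₁
fitsFirst-width (_  ∷ _  ∷ w₂ ∷ _  ∷ []) 2 = w₂
fitsFirst-width (_  ∷ _  ∷ _  ∷ w₃ ∷ []) 3 = w₃
fitsFirst-width {s} {col} (_ ∷ _ ∷ _ ∷ w₃ ∷ []) (suc (suc (suc (suc n)))) =
  trans (firstColumnOK-wide 8 (suc n) (profilePrecover s) (column col)) w₃

profileCount≡counts : ∀ n i → profileCount (lookup profiles i) n ≡ lookup (counts n) i
profileCount≡counts zero    i = trans (tilingCount-zero 8 (profilePrecover (lookup profiles i))) (sym (counts-zero i))
profileCount≡counts (suc n) i = begin
  profileCount s (suc n)
    ≡⟨ profileCount-admissible s n ⟩
  ∑ (admissibleColumns s) viaColumn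
    ≡⟨ ∑-Pointwise viaColumn viaTransition agree (transitions-correct i) ⟩
  ∑ (lookup transitions i) viaTransition
    ≡⟨ counts-suc n i ⟨
  lookup (counts (suc n)) i ∎
  where
  open ≡-Reasoning
  s = lookup profiles i
  viaColumn : Column → ℕ
  viaColumn col = if fitsFirst n s col then profileCount (nextProfile s (toList col)) n else 0
  viaTransition : Fin 52 × Bool → ℕ
  viaTransition (j , h) = if widthAllows n h then lookup (counts n) j else 0
  agree : ∀ {col t} → Transition s col t → viaColumn col ≡ viaTransition t
  agree {col} {j , h} (next≡ , widths) = cong₂ (λ b x → if b then x else 0)
    (fitsFirst-width {s} {col} {h} widths n) (trans (cong (λ s′ → profileCount s′ n) next≡) (profileCount≡counts n j))

numTilings≡tilings8 : ∀ n → numTilings 8 n ≡ tilings8 n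
numTilings≡tilings8 n = trans (numTilings≡tilingCount 8 n)
  (trans (tilingCount-cong 8 n noOverhang) (profileCount≡counts n (# 0)))
  where
  nth-replicate : ∀ {A : Set} (x : A) k r → nth x (List.replicate k x) r ≡ x
  nth-replicate x zero    r       = refl
  nth-replicate x (suc k) zero    = refl
  nth-replicate x (suc k) (suc r) = nth-replicate x k r
  noOverhang : ∀ r c → noPrecover r c ≡ profilePrecover (lookup profiles (# 0)) r c
  noOverhang r c = cong (λ x → b2n (c <ᵇ x)) (sym (nth-replicate 0 8 r))

-- Linear relations along a transfer map

module LinearRelation {J : Set} (T : J → List J) (v : ℕ → J → ℕ)
                      (v-suc : ∀ n j → v (suc n) j ≡ ∑ (T j) (v n)) (L : ℕ) where

  combination : (ℕ → ℕ) → ℕ → J → ℕ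
  combination w m j = ∑ (upTo L) (λ i → w i * v (m ∸ i) j)

  combination-suc : (w : ℕ → ℕ) {m : ℕ} → L ≤ suc m → ∀ j →
    combination w (suc m) j ≡ ∑ (T j) (combination w m)
  combination-suc w {m} L≤1+m j = begin
    ∑ (upTo L) (λ i → w i * v (suc m ∸ i) j)
      ≡⟨ ∑-cong-< L (λ {i} i<L → cong (λ n → w i * v n j) (+-∸-assoc 1 (below i<L))) ⟩
    ∑ (upTo L) (λ i → w i * v (suc (m ∸ i)) j)
      ≡⟨ ∑-cong (upTo L) (λ i → trans (cong (w i *_) (v-suc (m ∸ i) j)) (*-distribˡ-∑ (w i) (T j) (v (m ∸ i)))) ⟩
    ∑ (upTo L) (λ i → ∑ (T j) (λ p → w i * v (m ∸ i) p))
      ≡⟨ ∑-comm (upTo L) (T j) (λ i p → w i * v (m ∸ i) p) ⟩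
    ∑ (T j) (combination w m) ∎
    where
    open ≡-Reasoning
    below : ∀ {i} → i < L → i ≤ m
    below i<L with ≤-trans i<L L≤1+m
    ... | s≤s i≤m = i≤m

  relation-propagates : (P Q : ℕ → ℕ) (m₀ : ℕ) → L ≤ suc m₀ →
    (∀ j → combination P m₀ j ≡ combination Q m₀ j) →
    ∀ u j → combination P (m₀ + u) j ≡ combination Q (m₀ + u) j
  relation-propagates P Q m₀ L≤ base zero    j rewrite +-identityʳ m₀ = base j
  relation-propagates P Q m₀ L≤ base (suc u) j rewrite +-suc m₀ u =
    trans (combination-suc P L≤′ j)
      (trans (∑-cong (T j) (relation-propagates P Q m₀ L≤ base u)) (sym (combination-suc Q L≤′ j)))
    where
    L≤′ : L ≤ suc (m₀ + u)
    L≤′ = ≤-trans L≤ (s≤s (m≤m+n m₀ u))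

combineᵥ : {k : ℕ} → (ℕ → ℕ) → (ℕ → Vec ℕ k) → List ℕ → Vec ℕ k
combineᵥ {k} w v = foldr (λ i acc → zipWith _+_ (Vec.map (w i *_) (v i)) acc) (replicate k 0)

lookup-combineᵥ : {k : ℕ} (w : ℕ → ℕ) (v : ℕ → Vec ℕ k) (is : List ℕ) (j : Fin k) →
  lookup (combineᵥ w v is) j ≡ ∑ is (λ i → w i * lookup (v i) j)
lookup-combineᵥ w v []       j = lookup-replicate j 0
lookup-combineᵥ w v (i ∷ is) j = trans (lookup-zipWith _+_ j (Vec.map (w i *_) (v i)) (combineᵥ w v is))
  (cong₂ _+_ (lookup-map j (w i *_) (v i)) (lookup-combineᵥ w v is j))

-- Imported only here: the prefix +_ would make ℕ sections such as (c +_) above ambiguous.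
open import Data.Integer using (+_)

a-even : ∀ n → a (n * 2) ≡ tilings8 n
a-even zero    = sym (counts-zero (# 0))
a-even (suc n) = cong₂ (λ r x → if r ≡ᵇ 0 then x else 0) (m*n%n≡0 (suc n) 2)
  (trans (cong (numTilings 8) (m*n/n≡m (suc n) 2)) (numTilings≡tilings8 (suc n)))

a-odd : ∀ n → a (suc (n * 2)) ≡ 0
a-odd n = cong (λ r → if r ≡ᵇ 0 then numTilings 8 (suc (n * 2) / 2) else 0) ([m+kn]%n≡m%n 1 n 2)

aComputed : ℕ → ℕ
aComputed zero    = 1
aComputed (suc k) = if (suc k % 2) ≡ᵇ 0 then tilings8 (suc k / 2) else 0

a≡aComputed : ∀ N → a N ≡ aComputed N
a≡aComputed zero    = refl
a≡aComputed (suc k) = cong (if (suc k % 2) ≡ᵇ 0 then_else 0) (numTilings≡tilings8 (suc k / 2))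

posPart negPart : ℤ → ℕ
posPart (+ n)    = n
posPart -[1+ n ] = 0
negPart (+ n)    = 0
negPart -[1+ n ] = suc n

posPart-negPart : ∀ z → z ≡ + posPart z ℤ.- + negPart z
posPart-negPart (+ n)    = sym (ℤₚ.+-identityʳ (+ n))
posPart-negPart -[1+ n ] = refl

∑ℤ-split : (c : ℕ → ℤ) (g : ℕ → ℕ) (ks : List ℕ) →
  foldr ℤ._+_ (+ 0) (map (λ k → c k ℤ.* + g k) ks) ≡
  + ∑ ks (λ k → posPart (c k) * g k) ℤ.- + ∑ ks (λ k → negPart (c k) * g k)
∑ℤ-split c g []       = refl
∑ℤ-split c g (k ∷ ks) = begin
  c k ℤ.* + g k ℤ.+ foldr ℤ._+_ (+ 0) (map (λ k → c k ℤ.* + g k) ks)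
    ≡⟨ cong₂ (λ x y → x ℤ.* + g k ℤ.+ y) (posPart-negPart (c k)) (∑ℤ-split c g ks) ⟩
  (+ p ℤ.- + n) ℤ.* + g k ℤ.+ (+ P ℤ.- + N)
    ≡⟨ regroup (+ p) (+ n) (+ g k) (+ P) (+ N) ⟩
  (+ p ℤ.* + g k ℤ.+ + P) ℤ.- (+ n ℤ.* + g k ℤ.+ + N)
    ≡⟨ cong₂ ℤ._-_ (embed p P) (embed n N) ⟨
  + (p * g k + P) ℤ.- + (n * g k + N) ∎
  where
  open ≡-Reasoning
  p = posPart (c k)
  n = negPart (c k)
  P = ∑ ks (λ k → posPart (c k) * g k)
  N = ∑ ks (λ k → negPart (c k) * g k)
  regroup : ∀ (x y z X Y : ℤ) → (x ℤ.- y) ℤ.* z ℤ.+ (X ℤ.- Y) ≡ (x ℤ.* z ℤ.+ X) ℤ.- (y ℤ.* z ℤ.+ Y)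
  regroup = ℤ-Solver.solve-∀
  embed : ∀ x X → + (x * g k + X) ≡ + x ℤ.* + g k ℤ.+ + X
  embed x X = trans (ℤₚ.pos-+ (x * g k) X) (cong (ℤ._+ + X) (ℤₚ.pos-* x (g k)))

data EvenOrOdd : ℕ → Set where
  even : ∀ u → EvenOrOdd (u * 2)
  odd  : ∀ u → EvenOrOdd (suc (u * 2))

evenOrOdd : ∀ n → EvenOrOdd n
evenOrOdd zero = even 0
evenOrOdd (suc n) with evenOrOdd n
... | even u = odd u
... | odd u  = even (suc u)

qE : ℕ → ℤ
qE = nth (+ 0) qEven

coeff-q-even : ∀ i → coeff qPoly (i * 2) ≡ qE i
coeff-q-even = spread-even qEven
  where
  spread-even : (xs : List ℤ) (i : ℕ) → nth (+ 0) (spread xs) (i * 2) ≡ nth (+ 0) xs i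
  spread-even []       zero    = refl
  spread-even []       (suc i) = refl
  spread-even (x ∷ xs) zero    = refl
  spread-even (x ∷ xs) (suc i) = spread-even xs i

coeff-q-odd : ∀ i → coeff qPoly (suc (i * 2)) ≡ + 0
coeff-q-odd = spread-odd qEven
  where
  spread-odd : (xs : List ℤ) (i : ℕ) → nth (+ 0) (spread xs) (suc (i * 2)) ≡ + 0
  spread-odd []       i       = refl
  spread-odd (x ∷ xs) zero    = refl
  spread-odd (x ∷ xs) (suc i) = spread-odd xs i

convPart : (ℤ → ℕ) → ℕ → ℕ
convPart w N = ∑ (upTo (suc N)) (λ k → w (coeff qPoly k) * a (N ∸ k))

convQA≡convParts : ∀ N → convQA N ≡ + convPart posPart N ℤ.- + convPart negPart N
convQA≡convParts N = ∑ℤ-split (coeff qPoly) (λ k → a (N ∸ k)) (upTo (suc N))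

evenPart : (ℤ → ℕ) → ℕ → ℕ
evenPart w N = ∑ (upTo 23) (λ i → w (qE i) * a (N ∸ i * 2))

convPart≡evenPart : (w : ℤ → ℕ) → w (+ 0) ≡ 0 → ∀ t → convPart w (50 + t) ≡ evenPart w (50 + t)
convPart≡evenPart w w0 t = begin
  ∑ (upTo (46 + (5 + t))) term
    ≡⟨ ∑-upTo-+ term 46 (5 + t) ⟩
  ∑ (upTo (23 * 2)) term + ∑ (upTo (5 + t)) (λ i → term (46 + i))
    ≡⟨ cong₂ _+_ (∑-upTo-*2 term 23) (∑-zero (upTo (5 + t)) (λ i → vanishing)) ⟩
  ∑ (upTo 23) (λ i → term (i * 2)) + ∑ (upTo 23) (λ i → term (suc (i * 2))) + 0
    ≡⟨ cong (λ x → x + 0) (cong₂ _+_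
         (∑-cong (upTo 23) (λ i → cong (λ c → w c * a (N ∸ i * 2)) (coeff-q-even i)))
         (∑-zero (upTo 23) (λ i → trans (cong (λ c → w c * a (N ∸ suc (i * 2))) (coeff-q-odd i)) vanishing))) ⟩
  evenPart w N + 0 + 0
    ≡⟨ trans (+-identityʳ _) (+-identityʳ _) ⟩
  evenPart w N ∎
  where
  open ≡-Reasoning
  N = 50 + t
  term : ℕ → ℕ
  term k = w (coeff qPoly k) * a (N ∸ k)
  vanishing : ∀ {x} → w (+ 0) * x ≡ 0
  vanishing {x} = cong (_* x) w0

evenPart-odd : (w : ℤ → ℕ) (m : ℕ) → 22 ≤ m → evenPart w (suc (m * 2)) ≡ 0
evenPart-odd w m 22≤m = trans (∑-cong-< 23 {g = λ _ → 0} (λ {i} i<23 → begin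
  w (qE i) * a (suc (m * 2) ∸ i * 2)   ≡⟨ cong (λ n → w (qE i) * a n) (+-∸-assoc 1 (*-monoˡ-≤ 2 (i≤m i<23))) ⟩
  w (qE i) * a (suc (m * 2 ∸ i * 2))   ≡⟨ cong (λ n → w (qE i) * a (suc n)) (*-distribʳ-∸ 2 m i) ⟨
  w (qE i) * a (suc ((m ∸ i) * 2))     ≡⟨ cong (w (qE i) *_) (a-odd (m ∸ i)) ⟩
  w (qE i) * 0                         ≡⟨ *-zeroʳ (w (qE i)) ⟩
  0                                    ∎))
  (∑-zero (upTo 23) (λ _ → refl))
  where
  open ≡-Reasoning
  i≤m : ∀ {i} → i < 23 → i ≤ m
  i≤m (s≤s i≤22) = ≤-trans i≤22 22≤m

evenPart-even : (w : ℤ → ℕ) (m : ℕ) → evenPart w (m * 2) ≡ ∑ (upTo 23) (λ i → w (qE i) * tilings8 (m ∸ i))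
evenPart-even w m = ∑-cong (upTo 23) (λ i →
  cong (w (qE i) *_) (trans (cong a (sym (*-distribʳ-∸ 2 m i))) (a-even (m ∸ i))))

counts-suc-wide : ∀ n j → lookup (counts (3 + suc n)) j ≡ ∑ (map proj₁ (lookup transitions j)) (lookup (counts (3 + n)))
counts-suc-wide n j = trans (counts-suc (3 + n) j) (sym (∑-map proj₁ (lookup transitions j) (lookup (counts (3 + n)))))

-- From width 3 on every transition fits, hence the shift by 3.
open LinearRelation (λ j → map proj₁ (lookup transitions j)) (λ n j → lookup (counts (3 + n)) j) counts-suc-wide 23

window : ℕ → Vec ℕ 52
window i = counts (3 + (22 ∸ i))

-- Checked on whole vectors, so that each count vector is computed only once.
opaque
  unfolding counts

  window-relation : combineᵥ (λ i → posPart (qE i)) window (upTo 23) ≡ combineᵥ (λ i → negPart (qE i)) window (upTo 23)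
  window-relation = toWitness {a? = Vec.≡-dec _≟_ (combineᵥ (λ i → posPart (qE i)) window (upTo 23))
                                             (combineᵥ (λ i → negPart (qE i)) window (upTo 23))} _

tilings8-relation : ∀ u →
  ∑ (upTo 23) (λ i → posPart (qE i) * tilings8 (25 + u ∸ i)) ≡ ∑ (upTo 23) (λ i → negPart (qE i) * tilings8 (25 + u ∸ i))
tilings8-relation u = begin
  ∑ (upTo 23) (λ i → posPart (qE i) * tilings8 (25 + u ∸ i))
    ≡⟨ ∑-cong-< 23 (shift posPart) ⟩
  combination (λ i → posPart (qE i)) (22 + u) (# 0)
    ≡⟨ relation-propagates (λ i → posPart (qE i)) (λ i → negPart (qE i)) 22 ≤-refl base u (# 0) ⟩
  combination (λ i → negPart (qE i)) (22 + u) (# 0)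
    ≡⟨ ∑-cong-< 23 (shift negPart) ⟨
  ∑ (upTo 23) (λ i → negPart (qE i) * tilings8 (25 + u ∸ i)) ∎
  where
  open ≡-Reasoning
  shift : ∀ w {i} → i < 23 → w (qE i) * tilings8 (25 + u ∸ i) ≡ w (qE i) * lookup (counts (3 + (22 + u ∸ i))) (# 0)
  shift w {i} (s≤s i≤22) = cong (λ n → w (qE i) * lookup (counts n) (# 0)) (+-∸-assoc 3 (≤-trans i≤22 (m≤m+n 22 u)))
  base : ∀ j → combination (λ i → posPart (qE i)) 22 j ≡ combination (λ i → negPart (qE i)) 22 j
  base j = trans (sym (lookup-combineᵥ (λ i → posPart (qE i)) window (upTo 23) j))
                 (trans (cong (λ v → lookup v j) window-relation) (lookup-combineᵥ (λ i → negPart (qE i)) window (upTo 23) j))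

evenParts-balanced : ∀ {t} → EvenOrOdd t → evenPart posPart (50 + t) ≡ evenPart negPart (50 + t)
evenParts-balanced (even u) = trans (evenPart-even posPart (25 + u))
  (trans (tilings8-relation u) (sym (evenPart-even negPart (25 + u))))
evenParts-balanced (odd u)  = trans (evenPart-odd posPart (25 + u) (m≤m+n 22 (3 + u)))
  (sym (evenPart-odd negPart (25 + u) (m≤m+n 22 (3 + u))))

-- p has degree 36, so coeff pPoly (50 + t) computes to + 0.
convQA-large : ∀ t → convQA (50 + t) ≡ coeff pPoly (50 + t)
convQA-large t = begin
  convQA N                                        ≡⟨ convQA≡convParts N ⟩
  + convPart posPart N ℤ.- + convPart negPart N   ≡⟨ cong (λ x → + x ℤ.- + convPart negPart N) balanced ⟩
  + convPart negPart N ℤ.- + convPart negPart N   ≡⟨ ℤₚ.+-inverseʳ (+ convPart negPart N) ⟩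
  + 0                                             ∎
  where
  open ≡-Reasoning
  N = 50 + t
  balanced : convPart posPart N ≡ convPart negPart N
  balanced = trans (convPart≡evenPart posPart refl t)
               (trans (evenParts-balanced (evenOrOdd t)) (sym (convPart≡evenPart negPart refl t)))

convComputed : ℕ → ℤ
convComputed N = foldr ℤ._+_ (+ 0) (map (λ k → coeff qPoly k ℤ.* + aComputed (N ∸ k)) (upTo (suc N)))

opaque
  unfolding counts

  convComputed-small : All (λ N → convComputed N ≡ coeff pPoly N) (upTo 50)
  convComputed-small = toWitness {a? = all? (λ N → convComputed N ℤ.≟ coeff pPoly N) (upTo 50)} _

  series : map aComputed (upTo 19) ≡ 1 ∷ 0 ∷ 1 ∷ 0 ∷ 1 ∷ 0 ∷ 1 ∷ 0 ∷ 7 ∷ 0 ∷ 15 ∷ 0 ∷ 25 ∷ 0 ∷ 37 ∷ 0 ∷ 100 ∷ 0 ∷ 229 ∷ []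
  series = toWitness {a? = List.≡-dec _≟_ (map aComputed (upTo 19)) _} _

convQA-small : ∀ N → N < 50 → convQA N ≡ coeff pPoly N
convQA-small N N<50 = trans
  (cong (foldr ℤ._+_ (+ 0)) (map-cong (λ k → cong (λ x → coeff qPoly k ℤ.* + x) (a≡aComputed (N ∸ k))) (upTo (suc N))))
  (applyUpTo⁻ id 50 convComputed-small N<50)

mainTheorem7 : ((N : ℕ) → convQA N ≡ coeff pPoly N)
    × (map a (upTo 19) ≡ 1 ∷ 0 ∷ 1 ∷ 0 ∷ 1 ∷ 0 ∷ 1 ∷ 0 ∷ 7 ∷ 0 ∷ 15 ∷ 0 ∷ 25 ∷ 0 ∷ 37 ∷ 0 ∷ 100 ∷ 0 ∷ 229 ∷ [])
mainTheorem7 = coefficient , trans (map-cong a≡aComputed (upTo 19)) series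
  where
  coefficient : ∀ N → convQA N ≡ coeff pPoly N
  coefficient N = bySize (N <? 50)
    where
    bySize : Dec (N < 50) → convQA N ≡ coeff pPoly N
    bySize (yes N<50) = convQA-small N N<50
    bySize (no  N≮50) = subst (λ M → convQA M ≡ coeff pPoly M) (m+[n∸m]≡n (≮⇒≥ N≮50)) (convQA-large (N ∸ 50))
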